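{- Let $\mathbb{F}$ be a field, let $n,r,D\ge 1$, and let $x_{i,j}$ ($i\in\{0,\ldots,n-1\}$, $j\in\{1,\ldots,D\}$) be commuting variables. Let $\mathcal{H}\subseteq\mathbb{F}^{\{0,\ldots,n-1\}\times\{1,\ldots,D\}}$ be a hitting set for the set-multilinear polynomials, with respect to the known variable partition $\bigsqcup_{j=1}^{D}\{x_{i,j}\}_{i=0}^{n-1}$, that are computed by set-multilinear ABPs of width $\le r(D+1)$ and depth $\le D$. Define $\mathcal{H}'\subseteq(\mathbb{F}^{(D+1)\times(D+1)})^{n}$ by replacing each point $h\in\mathcal{H}$ with the tuple $(X_{0,D}(h),\ldots,X_{n-1,D}(h))$. Then $\mathcal{H}'$ is a hitting set for non-commutative polynomials computed by non-commutative ABPs of width $r$ and depth $D$ in the variables $x_0,\ldots,x_{n-1}$.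
   Context: For $i\in\{0,\ldots,n-1\}$, $X_{i,D}$ is the $(D+1)\times(D+1)$ matrix with rows and columns indexed by $0,\ldots,D$. Its $(k,\ell)$ entry equals $x_{i,\ell}$ if $k+1=\ell$, and $0$ otherwise. Thus $X_{i,D}$ has $x_{i,1},\ldots,x_{i,D}$ on its superdiagonal. $X_{i,D}(h)$ denotes the result of substituting the values from $h$ for the variables $x_{i,j}$. A (commutative or non-commutative) ABP is a directed acyclic graph with vertices in levels $0,\ldots,D$, a single source at level $0$ and a single sink at level $D$. Edges go only between consecutive levels. It computes the sum, over source-to-sink paths, of the ordered product of the edge labels. The width is the maximum number of vertices in a level. In a non-commutative ABP the labels are affine functions in the non-commuting variables $x_0,\ldots,x_{n-1}$. In a set-multilinear ABP of depth $\ell$ with respect to the partition above, the edges from level $j-1$ to level $j$ are labeled by homogeneous linear forms in $\{x_{i,j}\}_i$. A set $\mathcal{H}$ of points is a hitting set for a class if every polynomial $f$ in the class satisfies $f\equiv0$ if and only if $f$ vanishes on all points of $\mathcal{H}$. In the non-commutative case, $f$ is evaluated at tuples of matrices, with a scalar $a$ interpreted as $a\mathrm{I}$. -}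

module Defs where

open import Level using (Level; _⊔_)
open import Algebra.Bundles using (CommutativeRing)
open import Data.Nat as ℕ using (ℕ; zero; suc; _≤_)
open import Data.Fin using (Fin; zero; suc; toℕ; inject≤)
open import Data.List using (List; []; _∷_)
open import Data.Vec using (Vec; []; _∷_)
open import Data.Product using (Σ; ∃; _×_; _,_)
open import Relation.Nullary using (¬_; yes; no)
open import Relation.Binary.PropositionalEquality using (_≡_)

record Field (c ℓ : Level) : Set (Level.suc (c ⊔ ℓ)) where
  field
    commutativeRing : CommutativeRing c ℓ
  open CommutativeRing commutativeRing public
  field
    1≉0     : ¬ (1# ≈ 0#)
    inverse : ∀ x → ¬ (x ≈ 0#) → ∃ λ y → (x * y) ≈ 1#

module WithField {c ℓ : Level} (F : Field c ℓ) where
  open Field F using (Carrier; _≈_; 0#; 1#) renaming (_*_ to _·_; _+_ to _⊕_)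

  Σ[_] : (k : ℕ) → (Fin k → Carrier) → Carrier
  Σ[ zero ] f = 0#
  Σ[ suc k ] f = f zero ⊕ Σ[ k ] (λ i → f (suc i))

  Mat : ℕ → Set c
  Mat m = Fin m → Fin m → Carrier

  0M : ∀ {m} → Mat m
  0M _ _ = 0#

  IM : ∀ {m} → Mat m
  IM zero    zero    = 1#
  IM zero    (suc _) = 0#
  IM (suc _) zero    = 0#
  IM (suc i) (suc j) = IM i j

  _+M_ : ∀ {m} → Mat m → Mat m → Mat m
  (A +M B) i j = A i j ⊕ B i j

  _*M_ : ∀ {m} → Mat m → Mat m → Mat m
  _*M_ {m} A B i j = Σ[ m ] (λ k → A i k · B k j)

  _•M_ : ∀ {m} → Carrier → Mat m → Mat m
  (a •M A) i j = a · A i j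

  ΣM[_] : ∀ {m} (k : ℕ) → (Fin k → Mat m) → Mat m
  ΣM[ zero ] f = 0M
  ΣM[ suc k ] f = f zero +M ΣM[ k ] (λ i → f (suc i))

  _≈M_ : ∀ {m} → Mat m → Mat m → Set ℓ
  A ≈M B = ∀ i j → A i j ≈ B i j

  record Affine (n : ℕ) : Set c where
    field
      const : Carrier
      lin   : Fin n → Carrier
  open Affine public

  -- NCLayers n r d a : the last d layers of an ABP, starting at a level
  -- with a vertices and ending in the single sink.  Each layer is given
  -- by the matrix of edge labels between consecutive levels (label 0 =
  -- no edge); every level after the start has at most r vertices.
  data NCLayers (n r : ℕ) : (d a : ℕ) → Set c where
    sink  : NCLayers n r 0 1
    layer : ∀ {d a b} → b ≤ r → (Fin a → Fin b → Affine n) →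
            NCLayers n r d b → NCLayers n r (suc d) a

  NCABP : (n r D : ℕ) → Set c
  NCABP n r D = NCLayers n r D 1

  -- Coefficient of the word (monomial) w in the polynomial computed from
  -- vertex k of the start level to the sink (sum over paths of the
  -- ordered product of the edge labels, expanded).
  ncCoeff : ∀ {n r d a} → NCLayers n r d a → List (Fin n) → Fin a → Carrier
  ncCoeff sink [] _ = 1#
  ncCoeff sink (_ ∷ _) _ = 0#
  ncCoeff (layer {b = b} _ M L) [] k =
    Σ[ b ] (λ v → const (M k v) · ncCoeff L [] v)
  ncCoeff (layer {b = b} _ M L) (i ∷ w) k =
    Σ[ b ] (λ v → const (M k v) · ncCoeff L (i ∷ w) v)
    ⊕ Σ[ b ] (λ v → lin (M k v) i · ncCoeff L w v)

  ncPoly : ∀ {n r D} → NCABP n r D → List (Fin n) → Carrier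
  ncPoly P w = ncCoeff P w zero

  NCZero : ∀ {n} → (List (Fin n) → Carrier) → Set ℓ
  NCZero f = ∀ w → f w ≈ 0#

  sumWords : ∀ {n m} (k : ℕ) → (List (Fin n) → Mat m) → Mat m
  sumWords {n} zero g = g []
  sumWords {n} (suc k) g = ΣM[ n ] (λ i → sumWords k (λ w → g (i ∷ w)))

  monM : ∀ {n m} → (Fin n → Mat m) → List (Fin n) → Mat m
  monM A [] = IM
  monM A (i ∷ w) = A i *M monM A w

  evalNC : ∀ {n m} (D : ℕ) → (List (Fin n) → Carrier) → (Fin n → Mat m) → Mat m
  evalNC D f A =
    ΣM[ suc D ] (λ k → sumWords (toℕ k) (λ w → f w •M monM A w))

  NCHittingSet : (n r D m : ℕ) → ((Fin n → Mat m) → Set (c ⊔ ℓ)) → Set (c ⊔ ℓ)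
  NCHittingSet n r D m H = ∀ (P : NCABP n r D) →
    (NCZero (ncPoly P) → ∀ A → H A → evalNC D (ncPoly P) A ≈M 0M)
    × ((∀ A → H A → evalNC D (ncPoly P) A ≈M 0M) → NCZero (ncPoly P))

  -- Set-multilinear ABPs w.r.t. the partition ⊔_{j} {x_{i,j}}_i.
  -- SMLayers n w d a : the last d layers; the t-th layer (counting from
  -- the start) is labelled by linear forms Σ_i b_i x_{i,t}.

  data SMLayers (n w : ℕ) : (d a : ℕ) → Set c where
    sink  : SMLayers n w 0 1
    layer : ∀ {d a b} → b ≤ w → (Fin a → Fin b → (Fin n → Carrier)) →
            SMLayers n w d b → SMLayers n w (suc d) a

  SMABP : (n w d : ℕ) → Set c
  SMABP n w d = SMLayers n w d 1

  -- coefficient of the monomial x_{i_1,1} ⋯ x_{i_d,d}, for is = (i_1,…,i_d)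
  smCoeff : ∀ {n w d a} → SMLayers n w d a → Vec (Fin n) d → Fin a → Carrier
  smCoeff sink [] _ = 1#
  smCoeff (layer {b = b} _ M L) (i ∷ is) k =
    Σ[ b ] (λ v → M k v i · smCoeff L is v)

  smPoly : ∀ {n w d} → SMABP n w d → Vec (Fin n) d → Carrier
  smPoly P is = smCoeff P is zero

  SMZero : ∀ {n d} → (Vec (Fin n) d → Carrier) → Set ℓ
  SMZero f = ∀ is → f is ≈ 0#

  sumVec : ∀ {n} (k : ℕ) → (Vec (Fin n) k → Carrier) → Carrier
  sumVec zero g = g []
  sumVec {n} (suc k) g = Σ[ n ] (λ i → sumVec k (λ is → g (i ∷ is)))

  -- value of x_{i_1,1} ⋯ x_{i_k,k} at p (p i t = value of x_{i,t+1})
  monSM : ∀ {n k} → Vec (Fin n) k → (Fin n → Fin k → Carrier) → Carrier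
  monSM [] p = 1#
  monSM (i ∷ is) p = p i zero · monSM is (λ i' t → p i' (suc t))

  evalSM : ∀ {n d} → (Vec (Fin n) d → Carrier) → (Fin n → Fin d → Carrier) → Carrier
  evalSM {d = d} f p = sumVec d (λ is → f is · monSM is p)

  -- points of F^{{0..n-1}×{1..D}}: h i j = value of x_{i,j+1}
  Point : (n D : ℕ) → Set c
  Point n D = Fin n → Fin D → Carrier

  restrict : ∀ {n d D} → d ≤ D → Point n D → Point n d
  restrict d≤D h i j = h i (inject≤ j d≤D)

  SMHittingSet : (n w D : ℕ) → (Point n D → Set (c ⊔ ℓ)) → Set (c ⊔ ℓ)
  SMHittingSet n w D H = ∀ d (d≤D : d ≤ D) (P : SMABP n w d) →
    (SMZero (smPoly P) → ∀ h → H h → evalSM (smPoly P) (restrict d≤D h) ≈ 0#)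
    × ((∀ h → H h → evalSM (smPoly P) (restrict d≤D h) ≈ 0#) → SMZero (smPoly P))

  -- The matrices X_{i,D}(h): (k,l) entry is x_{i,l}(h) if k+1 = l, else 0.

  Xmat : ∀ {n D} → Point n D → Fin n → Mat (suc D)
  Xmat h i k zero = 0#
  Xmat h i k (suc l) with toℕ k ℕ.≟ toℕ l
  ... | yes _ = h i l
  ... | no  _ = 0#

  liftHS : ∀ {n D} → (Point n D → Set (c ⊔ ℓ)) → (Fin n → Mat (suc D)) → Set (c ⊔ ℓ)
  liftHS {n} {D} H A = Σ (Point n D) (λ h → H h × (A ≡ Xmat h))

module Submission where

-- At the matrices X_{i,D}(h), row 0 of the product X_{w₁} ⋯ X_{w_k} is the monomial
-- x_{w₁,1} ⋯ x_{w_k,k} (h) in column k and zero elsewhere, so entry (0, m) of f(X(h)) is the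
-- degree-m part of f read as a set-multilinear polynomial in the first m parts of the variables.
-- That part is computed by a set-multilinear ABP of width r(D+1) whose vertices are pairs
-- (vertex u, number p of layers consumed): one of its edges reads a variable through a run of
-- constant edges followed by a single linear edge.  So the hypothesis on H kills every
-- homogeneous part of f of degree ≤ D, and the parts of higher degree vanish because f has depth D.

open import Defs
open import Level using (Level; _⊔_)
open import Data.Nat as ℕ using (ℕ; zero; suc; _≤_; _<_; _*_; z≤n; s≤s)
open import Data.Nat.Properties using (m≤n⇒m≤1+n; suc-injective; ≤-refl; ≤-reflexive; _≤?_; ≰⇒>)
open import Data.Fin using (Fin; zero; suc; toℕ; fromℕ<; inject≤; combine; remQuot; _↑ˡ_; _↑ʳ_)
open import Data.Fin.Properties using (remQuot-combine; toℕ-fromℕ<)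
open import Data.List using (List; []; _∷_; length; drop)
open import Data.Vec using (Vec; []; _∷_; toList; fromList)
open import Data.Vec.Properties using (toList∘fromList)
open import Data.Product using (Σ; _×_; _,_; proj₁; proj₂)
open import Data.Empty using (⊥-elim)
open import Relation.Nullary using (¬_; yes; no)
open import Relation.Binary.PropositionalEquality as ≡ using (_≡_)

extend : ∀ {x} {X : Set x} {a r} → a ≤ r → X → (Fin a → X) → Fin r → X
extend z≤n     d f j       = d
extend (s≤s p) d f zero    = f zero
extend (s≤s p) d f (suc j) = extend p d (λ u → f (suc u)) j

extend-inject≤ : ∀ {x} {X : Set x} {a r} (p : a ≤ r) (d : X) (f : Fin a → X) u →
  extend p d f (inject≤ u p) ≡ f u
extend-inject≤ (s≤s p) d f zero    = ≡.refl
extend-inject≤ (s≤s p) d f (suc u) = extend-inject≤ p d (λ u → f (suc u)) u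

module FieldProperties {c ℓ : Level} (F : Field c ℓ) where
  open Field F
    using (Carrier; _≈_; 0#; 1#; _+_; setoid; semiring; refl; sym; trans; reflexive;
           +-cong; +-congˡ; +-congʳ; *-cong; *-congˡ; *-congʳ; +-assoc; +-comm;
           +-identityˡ; +-identityʳ; *-assoc; *-identityʳ; zeroˡ; zeroʳ)
    renaming (_*_ to _·_)
  open WithField F
  open import Algebra.Properties.Semiring.Sum semiring
    using (sum; sum-cong-≋; ∑-comm; *-distribˡ-sum; *-distribʳ-sum)
  open import Relation.Binary.Reasoning.Setoid setoid

  Σ≈sum : ∀ k (f : Fin k → Carrier) → Σ[ k ] f ≈ sum f
  Σ≈sum zero    f = refl
  Σ≈sum (suc k) f = +-congˡ (Σ≈sum k (λ i → f (suc i)))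

  Σ-cong : ∀ k {f g : Fin k → Carrier} → (∀ i → f i ≈ g i) → Σ[ k ] f ≈ Σ[ k ] g
  Σ-cong k {f} {g} f≈g = trans (Σ≈sum k f) (trans (sum-cong-≋ f≈g) (sym (Σ≈sum k g)))

  Σ-0 : ∀ k {f : Fin k → Carrier} → (∀ i → f i ≈ 0#) → Σ[ k ] f ≈ 0#
  Σ-0 zero    f≈0 = refl
  Σ-0 (suc k) f≈0 = trans (+-cong (f≈0 zero) (Σ-0 k (λ i → f≈0 (suc i)))) (+-identityˡ 0#)

  Σ-comm : ∀ k m (f : Fin k → Fin m → Carrier) →
    Σ[ k ] (λ i → Σ[ m ] (f i)) ≈ Σ[ m ] (λ j → Σ[ k ] (λ i → f i j))
  Σ-comm k m f = begin
    Σ[ k ] (λ i → Σ[ m ] (f i))               ≈⟨ Σ≈sum k _ ⟩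
    sum (λ i → Σ[ m ] (f i))                  ≈⟨ sum-cong-≋ (λ i → Σ≈sum m (f i)) ⟩
    sum (λ i → sum (f i))                     ≈⟨ ∑-comm f ⟩
    sum (λ j → sum (λ i → f i j))             ≈⟨ sum-cong-≋ (λ j → Σ≈sum k (λ i → f i j)) ⟨
    sum (λ j → Σ[ k ] (λ i → f i j))          ≈⟨ Σ≈sum m _ ⟨
    Σ[ m ] (λ j → Σ[ k ] (λ i → f i j))       ∎

  *-distribˡ-Σ : ∀ k a (f : Fin k → Carrier) → a · Σ[ k ] f ≈ Σ[ k ] (λ i → a · f i)
  *-distribˡ-Σ k a f = begin
    a · Σ[ k ] f               ≈⟨ *-congˡ (Σ≈sum k f) ⟩
    a · sum f                  ≈⟨ *-distribˡ-sum a f ⟩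
    sum (λ i → a · f i)        ≈⟨ Σ≈sum k _ ⟨
    Σ[ k ] (λ i → a · f i)     ∎

  *-distribʳ-Σ : ∀ k a (f : Fin k → Carrier) → Σ[ k ] f · a ≈ Σ[ k ] (λ i → f i · a)
  *-distribʳ-Σ k a f = begin
    Σ[ k ] f · a               ≈⟨ *-congʳ (Σ≈sum k f) ⟩
    sum f · a                  ≈⟨ *-distribʳ-sum a f ⟩
    sum (λ i → f i · a)        ≈⟨ Σ≈sum k _ ⟨
    Σ[ k ] (λ i → f i · a)     ∎

  Σ-↑ : ∀ m k (g : Fin (m ℕ.+ k) → Carrier) →
    Σ[ m ℕ.+ k ] g ≈ Σ[ m ] (λ i → g (i ↑ˡ k)) + Σ[ k ] (λ j → g (m ↑ʳ j))
  Σ-↑ zero    k g = sym (+-identityˡ _)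
  Σ-↑ (suc m) k g = trans (+-congˡ (Σ-↑ m k _)) (sym (+-assoc _ _ _))

  Σ-combine : ∀ m k (g : Fin (m * k) → Carrier) →
    Σ[ m * k ] g ≈ Σ[ m ] (λ i → Σ[ k ] (λ j → g (combine i j)))
  Σ-combine zero    k g = refl
  Σ-combine (suc m) k g = trans (Σ-↑ k (m * k) g) (+-congˡ (Σ-combine m k _))

  Σ-remQuot : ∀ m k (g : Fin m × Fin k → Carrier) →
    Σ[ m * k ] (λ y → g (remQuot k y)) ≈ Σ[ m ] (λ i → Σ[ k ] (λ j → g (i , j)))
  Σ-remQuot m k g = trans (Σ-combine m k _)
    (Σ-cong m (λ i → Σ-cong k (λ j → reflexive (≡.cong g (remQuot-combine i j)))))

  Σ-single : ∀ N m (G : ℕ → Carrier) → m < N → (∀ j → ¬ j ≡ m → G j ≈ 0#) →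
    Σ[ N ] (λ k → G (toℕ k)) ≈ G m
  Σ-single (suc N) zero G _ G≈0 =
    trans (+-congˡ (Σ-0 N (λ k → G≈0 (suc (toℕ k)) (λ ())))) (+-identityʳ _)
  Σ-single (suc N) (suc m) G (s≤s m<N) G≈0 =
    trans (+-cong (G≈0 zero (λ ())) (Σ-single N m (λ j → G (suc j)) m<N
                                       (λ j j≢m → G≈0 (suc j) (λ e → j≢m (suc-injective e)))))
          (+-identityˡ _)

  sumVec-cong : ∀ {n} k {f g : Vec (Fin n) k → Carrier} → (∀ is → f is ≈ g is) →
    sumVec k f ≈ sumVec k g
  sumVec-cong zero        f≈g = f≈g []
  sumVec-cong {n} (suc k) f≈g = Σ-cong n (λ i → sumVec-cong k (λ is → f≈g (i ∷ is)))

  sumVec-0 : ∀ {n} k {f : Vec (Fin n) k → Carrier} → (∀ is → f is ≈ 0#) → sumVec k f ≈ 0#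
  sumVec-0 zero        f≈0 = f≈0 []
  sumVec-0 {n} (suc k) f≈0 = Σ-0 n (λ i → sumVec-0 k (λ is → f≈0 (i ∷ is)))

  Σ-extend : ∀ {x} {X : Set x} {a r} (p : a ≤ r) (d : X) (f : Fin a → X) (G : Fin r → X → Carrier) →
    (∀ j → G j d ≈ 0#) → Σ[ r ] (λ j → G j (extend p d f j)) ≈ Σ[ a ] (λ u → G (inject≤ u p) (f u))
  Σ-extend {r = r} z≤n d f G Gd≈0 = Σ-0 r Gd≈0
  Σ-extend (s≤s p) d f G Gd≈0 =
    +-congˡ (Σ-extend p d (λ u → f (suc u)) (λ j → G (suc j)) (λ j → Gd≈0 (suc j)))

  ΣM-entry : ∀ {m} k (G : Fin k → Mat m) a b → ΣM[ k ] G a b ≈ Σ[ k ] (λ t → G t a b)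
  ΣM-entry zero    G a b = refl
  ΣM-entry (suc k) G a b = +-congˡ (ΣM-entry k (λ t → G (suc t)) a b)

  sumWords-entry : ∀ {n m} k (g : List (Fin n) → Mat m) a b →
    sumWords k g a b ≈ sumVec k (λ is → g (toList is) a b)
  sumWords-entry zero        g a b = refl
  sumWords-entry {n} (suc k) g a b =
    trans (ΣM-entry n (λ i → sumWords k (λ w → g (i ∷ w))) a b)
          (Σ-cong n (λ i → sumWords-entry k (λ w → g (i ∷ w)) a b))

  evalNC-entry : ∀ {n m} D (f : List (Fin n) → Carrier) (A : Fin n → Mat m) a b →
    evalNC D f A a b ≈
      Σ[ suc D ] (λ k → sumVec (toℕ k) (λ is → f (toList is) · monM A (toList is) a b))
  evalNC-entry D f A a b =
    trans (ΣM-entry (suc D) (λ k → sumWords (toℕ k) (λ w → f w •M monM A w)) a b)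
    (Σ-cong (suc D) (λ k → sumWords-entry (toℕ k) (λ w → f w •M monM A w) a b))

  evalNC-NCZero : ∀ {n m} D {f : List (Fin n) → Carrier} → NCZero f →
    ∀ (A : Fin n → Mat m) → evalNC D f A ≈M 0M
  evalNC-NCZero D {f} f≈0 A a b = trans (evalNC-entry D f A a b)
    (Σ-0 (suc D) (λ k → sumVec-0 (toℕ k)
      (λ is → trans (*-congʳ (f≈0 (toList is))) (zeroˡ (monM A (toList is) a b)))))

  shift : ∀ {n D} → Point n (suc D) → Point n D
  shift h i j = h i (suc j)

  Xmat-shift : ∀ {n D} (h : Point n (suc D)) i a b →
    Xmat h i (suc a) (suc b) ≈ Xmat (shift h) i a b
  Xmat-shift h i a zero = refl
  Xmat-shift h i a (suc b) with toℕ (suc a) ℕ.≟ toℕ (suc b) | toℕ a ℕ.≟ toℕ b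
  ... | yes _   | yes _   = refl
  ... | no  _   | no  _   = refl
  ... | yes a≡b | no  a≢b = ⊥-elim (a≢b (suc-injective a≡b))
  ... | no  a≢b | yes a≡b = ⊥-elim (a≢b (≡.cong suc a≡b))

  module _ {n D : ℕ} (h : Point n D) where
    monM-Xmat-col0 : ∀ i w a → monM (Xmat h) (i ∷ w) a zero ≈ 0#
    monM-Xmat-sucˡ-col0 : ∀ w a → monM (Xmat h) w (suc a) zero ≈ 0#

    monM-Xmat-col0 i w a = trans
      (+-cong (zeroˡ _) (Σ-0 D (λ k → trans (*-congˡ (monM-Xmat-sucˡ-col0 w k)) (zeroʳ _))))
      (+-identityˡ 0#)

    monM-Xmat-sucˡ-col0 []      a = refl
    monM-Xmat-sucˡ-col0 (i ∷ w) a = monM-Xmat-col0 i w (suc a)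

  monM-Xmat-shift : ∀ {n D} (h : Point n (suc D)) w a b →
    monM (Xmat h) w (suc a) (suc b) ≈ monM (Xmat (shift h)) w a b
  monM-Xmat-shift h []      a b = refl
  monM-Xmat-shift {D = D} h (i ∷ w) a b = trans
    (+-cong (zeroˡ _) (Σ-cong (suc D) (λ k → *-cong (Xmat-shift h i a k) (monM-Xmat-shift h w k b))))
    (+-identityˡ _)

  monM-Xmat-row0-∷ : ∀ {n D} (h : Point n (suc D)) i w b →
    monM (Xmat h) (i ∷ w) zero (suc b) ≈ h i zero · monM (Xmat (shift h)) w zero b
  monM-Xmat-row0-∷ {D = D} h i w b = trans
    (+-cong (zeroˡ _) (+-cong (*-congˡ (monM-Xmat-shift h w zero b)) (Σ-0 D (λ k → zeroˡ _))))
    (trans (+-identityˡ _) (+-identityʳ _))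

  monM-Xmat-row0-≢ : ∀ {n D k} (h : Point n D) (is : Vec (Fin n) k) b → ¬ toℕ b ≡ k →
    monM (Xmat h) (toList is) zero b ≈ 0#
  monM-Xmat-row0-≢ h []       zero    b≢0 = ⊥-elim (b≢0 ≡.refl)
  monM-Xmat-row0-≢ h []       (suc b) b≢0 = refl
  monM-Xmat-row0-≢ h (i ∷ is) zero    b≢k = monM-Xmat-col0 h i (toList is) zero
  monM-Xmat-row0-≢ {D = suc D} h (i ∷ is) (suc b) b≢k = trans (monM-Xmat-row0-∷ h i (toList is) b)
    (trans (*-congˡ (monM-Xmat-row0-≢ (shift h) is b (λ e → b≢k (≡.cong suc e)))) (zeroʳ _))

  monM-Xmat-row0-≡ : ∀ {n D k} (h : Point n D) (is : Vec (Fin n) k) b → toℕ b ≡ k →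
    (k≤D : k ≤ D) → monM (Xmat h) (toList is) zero b ≈ monSM is (restrict k≤D h)
  monM-Xmat-row0-≡ h []       zero    b≡0 k≤D = refl
  monM-Xmat-row0-≡ {D = suc D} h (i ∷ is) (suc b) b≡k (s≤s k≤D) =
    trans (monM-Xmat-row0-∷ h i (toList is) b)
          (*-congˡ (monM-Xmat-row0-≡ (shift h) is b (suc-injective b≡k) k≤D))

  evalNC-Xmat-row0 : ∀ {n D m} (f : List (Fin n) → Carrier) (h : Point n D) (m≤D : m ≤ D) b →
    toℕ b ≡ m → evalNC D f (Xmat h) zero b ≈ evalSM {d = m} (λ is → f (toList is)) (restrict m≤D h)
  evalNC-Xmat-row0 {D = D} {m} f h m≤D b b≡m = trans (evalNC-entry D f (Xmat h) zero b)
    (trans (Σ-single (suc D) m degree (s≤s m≤D) otherDegrees)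
      (sumVec-cong m (λ is → *-congˡ (monM-Xmat-row0-≡ h is b b≡m m≤D))))
    where
    degree : ℕ → Carrier
    degree k = sumVec k (λ is → f (toList is) · monM (Xmat h) (toList is) zero b)
    otherDegrees : ∀ k → ¬ k ≡ m → degree k ≈ 0#
    otherDegrees k k≢m = sumVec-0 k (λ is → trans
      (*-congˡ (monM-Xmat-row0-≢ h is b (λ b≡k → k≢m (≡.trans (≡.sym b≡k) b≡m)))) (zeroʳ _))

  depth<length⇒ncCoeff≈0 : ∀ {n r d a} (L : NCLayers n r d a) w u → d < length w → ncCoeff L w u ≈ 0#
  depth<length⇒ncCoeff≈0 sink          (_ ∷ _) u _          = refl
  depth<length⇒ncCoeff≈0 (layer {b = b} _ M L) (i ∷ w) u (s≤s d<w) = trans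
    (+-cong (Σ-0 b (λ v → trans (*-congˡ (depth<length⇒ncCoeff≈0 L (i ∷ w) v (m≤n⇒m≤1+n d<w)))
                                (zeroʳ _)))
            (Σ-0 b (λ v → trans (*-congˡ (depth<length⇒ncCoeff≈0 L w v d<w)) (zeroʳ _))))
    (+-identityˡ 0#)

  module UniformLayers (n r′ : ℕ) where
    r : ℕ
    r = suc r′

    Layer : Set c
    Layer = Fin r → Fin r → Affine n

    0A : Affine n
    0A = record { const = 0# ; lin = λ _ → 0# }

    -- the sink is vertex zero of the last level
    uniformCoeff : List Layer → List (Fin n) → Fin r → Carrier
    uniformCoeff []       []      zero    = 1#
    uniformCoeff []       []      (suc _) = 0#
    uniformCoeff []       (_ ∷ _) _       = 0#
    uniformCoeff (M ∷ Ms) []      u       = Σ[ r ] (λ v → const (M u v) · uniformCoeff Ms [] v)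
    uniformCoeff (M ∷ Ms) (i ∷ w) u       =
      Σ[ r ] (λ v → const (M u v) · uniformCoeff Ms (i ∷ w) v)
      + Σ[ r ] (λ v → lin (M u v) i · uniformCoeff Ms w v)

    padLayer : ∀ {a b} → a ≤ r → b ≤ r → (Fin a → Fin b → Affine n) → Layer
    padLayer a≤r b≤r M = extend a≤r (λ _ → 0A) (λ u → extend b≤r 0A (M u))

    Σ-padLayer : ∀ {a b} (a≤r : a ≤ r) (b≤r : b ≤ r) (M : Fin a → Fin b → Affine n) u
      (φ : Affine n → Carrier) → φ 0A ≡ 0# → (g : Fin r → Carrier) →
      Σ[ r ] (λ v → φ (padLayer a≤r b≤r M (inject≤ u a≤r) v) · g v)
        ≈ Σ[ b ] (λ v → φ (M u v) · g (inject≤ v b≤r))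
    Σ-padLayer a≤r b≤r M u φ φ0A≡0 g = trans
      (Σ-cong r (λ v → *-congʳ {g v} (reflexive
        (≡.cong (λ row → φ (row v)) (extend-inject≤ a≤r (λ _ → 0A) (λ u → extend b≤r 0A (M u)) u)))))
      (Σ-extend b≤r 0A (M u) (λ v A → φ A · g v)
        (λ v → trans (*-congʳ {g v} (reflexive φ0A≡0)) (zeroˡ (g v))))

    pad : ∀ {d a} → NCLayers n r d a → a ≤ r → List Layer
    pad sink              _   = []
    pad (layer b≤r M L) a≤r = padLayer a≤r b≤r M ∷ pad L b≤r

    length-pad : ∀ {d a} (L : NCLayers n r d a) (a≤r : a ≤ r) → length (pad L a≤r) ≡ d
    length-pad sink            a≤r = ≡.refl
    length-pad (layer b≤r M L) a≤r = ≡.cong suc (length-pad L b≤r)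

    uniformCoeff-pad : ∀ {d a} (L : NCLayers n r d a) (a≤r : a ≤ r) w u →
      uniformCoeff (pad L a≤r) w (inject≤ u a≤r) ≈ ncCoeff L w u
    uniformCoeff-pad sink (s≤s _) []      zero = refl
    uniformCoeff-pad sink _       (_ ∷ _) _    = refl
    uniformCoeff-pad (layer {b = b} b≤r M L) a≤r [] u =
      trans (Σ-padLayer a≤r b≤r M u const ≡.refl (uniformCoeff (pad L b≤r) []))
            (Σ-cong b (λ v → *-congˡ (uniformCoeff-pad L b≤r [] v)))
    uniformCoeff-pad (layer {b = b} b≤r M L) a≤r (i ∷ w) u = +-cong
      (trans (Σ-padLayer a≤r b≤r M u const ≡.refl (uniformCoeff (pad L b≤r) (i ∷ w)))
             (Σ-cong b (λ v → *-congˡ (uniformCoeff-pad L b≤r (i ∷ w) v))))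
      (trans (Σ-padLayer a≤r b≤r M u (λ A → lin A i) ≡.refl (uniformCoeff (pad L b≤r) w))
             (Σ-cong b (λ v → *-congˡ (uniformCoeff-pad L b≤r w v))))

    -- letterAfter Ms q i u v: paths from u along q constant edges and then an x_i-edge into v;
    -- letterStep Ms p p′ is letterAfter (drop p Ms) (p′ ∸ p ∸ 1) when p < p′, and 0 otherwise.
    letterAfter : List Layer → ℕ → Fin n → Fin r → Fin r → Carrier
    letterAfter []       q       i u v = 0#
    letterAfter (M ∷ Ms) zero    i u v = lin (M u v) i
    letterAfter (M ∷ Ms) (suc q) i u v = Σ[ r ] (λ x → const (M u x) · letterAfter Ms q i x v)

    letterStep : List Layer → ℕ → ℕ → Fin n → Fin r → Fin r → Carrier
    letterStep Ms       zero    zero     i u v = 0#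
    letterStep Ms       zero    (suc p′) i u v = letterAfter Ms p′ i u v
    letterStep []       (suc p) p′       i u v = 0#
    letterStep (M ∷ Ms) (suc p) zero     i u v = 0#
    letterStep (M ∷ Ms) (suc p) (suc p′) i u v = letterStep Ms p p′ i u v

    uniformCoeff-∷ : ∀ Ms N → length Ms ≤ N → ∀ i w u →
      Σ[ N ] (λ q → Σ[ r ] (λ v → letterAfter Ms (toℕ q) i u v · uniformCoeff (drop (suc (toℕ q)) Ms) w v))
        ≈ uniformCoeff Ms (i ∷ w) u
    uniformCoeff-∷ [] N _ i w u = Σ-0 N (λ q → Σ-0 r (λ v → zeroˡ (uniformCoeff [] w v)))
    uniformCoeff-∷ (M ∷ Ms) (suc N) (s≤s Ms≤N) i w u = trans (+-comm _ _) (+-congʳ laterLetter)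
      where
      κ : Fin r → Carrier
      κ x = const (M u x)
      t : Fin r → Fin N → Fin r → Carrier
      t x q v = letterAfter Ms (toℕ q) i x v
      rest : Fin N → Fin r → Carrier
      rest q v = uniformCoeff (drop (suc (toℕ q)) Ms) w v
      laterLetter : Σ[ N ] (λ q → Σ[ r ] (λ v → Σ[ r ] (λ x → κ x · t x q v) · rest q v))
                    ≈ Σ[ r ] (λ x → κ x · uniformCoeff Ms (i ∷ w) x)
      laterLetter = begin
        Σ[ N ] (λ q → Σ[ r ] (λ v → Σ[ r ] (λ x → κ x · t x q v) · rest q v))
          ≈⟨ Σ-cong N (λ q → Σ-cong r (λ v → trans (*-distribʳ-Σ r (rest q v) (λ x → κ x · t x q v))
                                               (Σ-cong r (λ x → *-assoc (κ x) (t x q v) (rest q v))))) ⟩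
        Σ[ N ] (λ q → Σ[ r ] (λ v → Σ[ r ] (λ x → κ x · (t x q v · rest q v))))
          ≈⟨ Σ-cong N (λ q → Σ-comm r r (λ v x → κ x · (t x q v · rest q v))) ⟩
        Σ[ N ] (λ q → Σ[ r ] (λ x → Σ[ r ] (λ v → κ x · (t x q v · rest q v))))
          ≈⟨ Σ-comm N r (λ q x → Σ[ r ] (λ v → κ x · (t x q v · rest q v))) ⟩
        Σ[ r ] (λ x → Σ[ N ] (λ q → Σ[ r ] (λ v → κ x · (t x q v · rest q v))))
          ≈⟨ Σ-cong r (λ x → trans
               (Σ-cong N (λ q → sym (*-distribˡ-Σ r (κ x) (λ v → t x q v · rest q v))))
               (sym (*-distribˡ-Σ N (κ x) (λ q → Σ[ r ] (λ v → t x q v · rest q v))))) ⟩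
        Σ[ r ] (λ x → κ x · Σ[ N ] (λ q → Σ[ r ] (λ v → t x q v · rest q v)))
          ≈⟨ Σ-cong r (λ x → *-congˡ {κ x} (uniformCoeff-∷ Ms N Ms≤N i w x)) ⟩
        Σ[ r ] (λ x → κ x · uniformCoeff Ms (i ∷ w) x) ∎

    uniformCoeff-drop-∷ : ∀ Ms N → length Ms < N → ∀ p i w u →
      Σ[ N ] (λ p′ → Σ[ r ] (λ v →
        letterStep Ms p (toℕ p′) i u v · uniformCoeff (drop (toℕ p′) Ms) w v))
        ≈ uniformCoeff (drop p Ms) (i ∷ w) u
    uniformCoeff-drop-∷ Ms (suc N) (s≤s Ms≤N) zero i w u =
      trans (+-cong (Σ-0 r (λ v → zeroˡ (uniformCoeff Ms w v))) (uniformCoeff-∷ Ms N Ms≤N i w u))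
            (+-identityˡ _)
    uniformCoeff-drop-∷ [] (suc N) _ (suc p) i w u =
      trans (+-cong (Σ-0 r (λ v → zeroˡ (uniformCoeff [] w v)))
                    (Σ-0 N (λ q → Σ-0 r (λ v → zeroˡ (uniformCoeff [] w v)))))
            (+-identityˡ 0#)
    uniformCoeff-drop-∷ (M ∷ Ms) (suc N) (s≤s Ms<N) (suc p) i w u =
      trans (+-cong (Σ-0 r (λ v → zeroˡ (uniformCoeff (M ∷ Ms) w v)))
                    (uniformCoeff-drop-∷ Ms N Ms<N p i w u))
            (+-identityˡ _)

    module Slice (D : ℕ) (Ms : List Layer) (Ms≤D : length Ms ≤ D) where
      -- (u , p) is vertex u after the first p layers
      State : Set
      State = Fin r × Fin (suc D)

      coeffFrom : State → List (Fin n) → Carrier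
      coeffFrom (u , p) w = uniformCoeff (drop (toℕ p) Ms) w u

      transition : State → State → Fin n → Carrier
      transition (u , p) (v , p′) i = letterStep Ms (toℕ p) (toℕ p′) i u v

      coeffFrom-∷ : ∀ s i w →
        Σ[ r * suc D ] (λ y → transition s (remQuot (suc D) y) i · coeffFrom (remQuot (suc D) y) w)
          ≈ coeffFrom s (i ∷ w)
      coeffFrom-∷ (u , p) i w = begin
        Σ[ r * suc D ] (λ y → g (remQuot (suc D) y))
          ≈⟨ Σ-remQuot r (suc D) g ⟩
        Σ[ r ] (λ v → Σ[ suc D ] (λ p′ → g (v , p′)))
          ≈⟨ Σ-comm r (suc D) (λ v p′ → g (v , p′)) ⟩
        Σ[ suc D ] (λ p′ → Σ[ r ] (λ v → g (v , p′)))
          ≈⟨ uniformCoeff-drop-∷ Ms (suc D) (s≤s Ms≤D) (toℕ p) i w u ⟩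
        coeffFrom (u , p) (i ∷ w) ∎
        where
        g : State → Carrier
        g s = transition (u , p) s i · coeffFrom s w

      sliceLayers : ∀ k {a} → (Fin a → State) → SMLayers n (r * suc D) (suc k) a
      sliceLayers zero    st = layer (s≤s z≤n) (λ x _ i → coeffFrom (st x) (i ∷ [])) sink
      sliceLayers (suc k) st =
        layer ≤-refl (λ x y → transition (st x) (remQuot (suc D) y)) (sliceLayers k (remQuot (suc D)))

      smCoeff-sliceLayers : ∀ k {a} (st : Fin a → State) is x →
        smCoeff (sliceLayers k st) is x ≈ coeffFrom (st x) (toList is)
      smCoeff-sliceLayers zero    st (i ∷ []) x = trans (+-identityʳ _) (*-identityʳ _)
      smCoeff-sliceLayers (suc k) st (i ∷ is) x = trans
        (Σ-cong (r * suc D) (λ y → *-congˡ {transition (st x) (remQuot (suc D) y) i}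
                                              (smCoeff-sliceLayers k (remQuot (suc D)) is y)))
        (coeffFrom-∷ (st x) i (toList is))

  sliceABP : ∀ {n r′ D} (P : NCABP n (suc r′) D) m →
    Σ (SMABP n (suc r′ * suc D) (suc m)) (λ Q → ∀ is → smPoly Q is ≈ ncPoly P (toList is))
  sliceABP {n} {r′} {D} P m =
    sliceLayers m (λ _ → zero , zero) ,
    λ is → trans (smCoeff-sliceLayers m (λ _ → zero , zero) is zero)
                 (uniformCoeff-pad P (s≤s z≤n) (toList is) zero)
    where
    open UniformLayers n r′
    open Slice D (pad P (s≤s z≤n)) (≤-reflexive (length-pad P (s≤s z≤n)))

  -- Depth-0 programs only compute 1, so a constant a is tested through the
  -- depth-1 program computing a·(x_{0,1} + ⋯ + x_{n-1,1}).
  SMHittingSet-constant≈0 : ∀ {n w D H} → SMHittingSet n w D H → 1 ≤ w → 1 ≤ D → Fin n →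
    ∀ a → (∀ h → H h → a ≈ 0#) → a ≈ 0#
  SMHittingSet-constant≈0 {n} {w} {D} {H} hits 1≤w 1≤D i₀ a a≈0 = trans
    (sym (trans (+-identityʳ _) (*-identityʳ a)))
    (proj₂ (hits 1 1≤D linearForm) vanishes (i₀ ∷ []))
    where
    linearForm : SMABP n w 1
    linearForm = layer 1≤w (λ _ _ _ → a) sink
    vanishes : ∀ h → H h → evalSM (smPoly linearForm) (restrict 1≤D h) ≈ 0#
    vanishes h Hh = Σ-0 n (λ i → trans
      (*-congʳ (trans (+-identityʳ _) (trans (*-identityʳ a) (a≈0 h Hh)))) (zeroˡ _))

  SMHittingSet-slice≈0 : ∀ {n r′ D H} → SMHittingSet n (suc r′ * suc D) D H → 1 ≤ D → Fin n →
    (P : NCABP n (suc r′) D) → ∀ m (m≤D : m ≤ D) →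
    (∀ h → H h → evalSM {d = m} (λ is → ncPoly P (toList is)) (restrict m≤D h) ≈ 0#) →
    (is : Vec (Fin n) m) → ncPoly P (toList is) ≈ 0#
  SMHittingSet-slice≈0 hits 1≤D i₀ P zero _ vanish [] =
    SMHittingSet-constant≈0 hits (s≤s z≤n) 1≤D i₀ (ncPoly P [])
      (λ h Hh → trans (sym (*-identityʳ _)) (vanish h Hh))
  SMHittingSet-slice≈0 {n} {r′} {D} {H} hits 1≤D i₀ P (suc m) m≤D vanish is =
    trans (sym (Q≈P is)) (proj₂ (hits (suc m) m≤D Q) Q-vanishes is)
    where
    Q : SMABP n (suc r′ * suc D) (suc m)
    Q = proj₁ (sliceABP P m)
    Q≈P : ∀ is → smPoly Q is ≈ ncPoly P (toList is)
    Q≈P = proj₂ (sliceABP P m)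
    Q-vanishes : ∀ h → H h → evalSM (smPoly Q) (restrict m≤D h) ≈ 0#
    Q-vanishes h Hh = trans
      (sumVec-cong (suc m) (λ is → *-congʳ {monSM is (restrict m≤D h)} (Q≈P is))) (vanish h Hh)

mainTheorem5 : ∀ {c ℓ : Level} (F : Field c ℓ) → let open WithField F in
    (n r D : ℕ) → 1 ≤ n → 1 ≤ r → 1 ≤ D →
    (H : Point n D → Set (c ⊔ ℓ)) →
    SMHittingSet n (r * suc D) D H →
    NCHittingSet n r D (suc D) (liftHS H)
mainTheorem5 F (suc n′) (suc r′) D _ _ 1≤D H hits P =
  (λ f≈0 A _ → evalNC-NCZero D f≈0 A) , complete
  where
  open Field F using (_≈_; 0#; sym; trans)
  open WithField F
  open FieldProperties F
  complete : (∀ A → liftHS H A → evalNC D (ncPoly P) A ≈M 0M) → NCZero (ncPoly P)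
  complete vanish w with length w ≤? D
  ... | no  w≰D = depth<length⇒ncCoeff≈0 P w zero (≰⇒> w≰D)
  ... | yes w≤D = ≡.subst (λ w → ncPoly P w ≈ 0#) (toList∘fromList w)
        (SMHittingSet-slice≈0 hits 1≤D zero P (length w) w≤D row0-vanishes (fromList w))
    where
    b : Fin (suc D)
    b = fromℕ< (s≤s w≤D)
    row0-vanishes : ∀ h → H h → evalSM (λ is → ncPoly P (toList is)) (restrict w≤D h) ≈ 0#
    row0-vanishes h Hh = trans (sym (evalNC-Xmat-row0 (ncPoly P) h w≤D b (toℕ-fromℕ< (s≤s w≤D))))
                               (vanish (Xmat h) (h , Hh , ≡.refl) zero b)
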